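{- Let $n>2$, $n_1=n(n+1)/2$, let $[G]=(g_{ij})$ be a binding graph of order $n_1$, let $\mathrm{wl}([G])=(m_{ij})$, and let $\Phi=(\phi_{ij})$ be the $\phi$-graph induced by $\mathrm{wl}([G])$. Then $\mathrm{wl}(\Phi)\approx\mathrm{wl}([G])$, and $\mathrm{Aut}(\Phi)=\mathrm{Aut}(\mathrm{wl}(\Phi))=\mathrm{Aut}(\mathrm{wl}([G]))=\mathrm{Aut}([G])$.
   Context: Labeled graphs: $\mathrm{Var}$ is an infinite set of independent variables and $x_0\notin\mathrm{Var}$ a reserved symbol. A labeled graph of order $n$ is an $n\times n$ matrix $G=(g_{ij})$ with entries in $\{x_0\}\cup\mathrm{Var}$; vertex set $[n]$; $g_{ii}$ is the label of vertex $i$; for $i\neq j$, $(i,j)$ is an edge iff $g_{ij}\ne x_0$. $\mathrm{Var}(G)$ is the set of symbols in $G$, $\dim(G)=|\mathrm{Var}(G)|$. A simple graph has $G^\top=G$, $\dim(G)\le2$, $g_{ii}=x_0$. $\mathrm{Aut}(G)$ is the group of permutations $\sigma$ of $[n]$ with $g_{ij}=g_{i^\sigma j^\sigma}$ for all $i,j$. Diamond product: $(G\diamond G)_{ij}=\{\!\{(g_{ik},g_{kj}):k\in[n]\}\!\}$. $\mathrm{evs}(A)$ replaces entries of $A$ by variables of $\mathrm{Var}$ so that equal entries get equal variables and distinct entries distinct ones. $A\ge B$ means $b_{uv}=b_{st}\Rightarrow a_{uv}=a_{st}$; $A\approx B$ means $A\ge B$ and $B\ge A$. WL algorithm: $G_1$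 from $G$ by replacing diagonal entries by fresh variables (equal iff equal before, none occurring off-diagonal), $G_{t+1}=\mathrm{evs}(G_t\diamond G_t)$ until $\dim(G_t)=\dim(G_{t+1})$, $\mathrm{wl}(G):=G_t$ (defined up to $\approx$). Binding graphs: a binding graph of order $n_1=n(n+1)/2$ is a simple graph such that for every pair of distinct $u,v\in[n]$ there is a unique vertex $u\wedge v\in[n+1,n_1]$ whose neighbours are exactly $u$ and $v$, distinct pairs giving distinct vertices; the subgraph induced on $[n]$ is the basic graph $G$ and the binding graph is denoted $[G]$. $\phi$-graph: for a binding graph $[G]=(g_{ij})$ and a fixed representative $\mathrm{wl}([G])=(m_{ij})$, the induced $\phi$-graph $\Phi=(\phi_{ij})$ of order $n_1$ is given by $\phi_{ij}=x_0$ if $i\ne j$ and $g_{ij}=x_0$; $\phi_{ij}=x_0$ if $i,j\in[n]$, $i\neq j$ and $g_{ij}\neq x_0$; and $\phi_{ij}=m_{ij}$ otherwise (i.e. it keeps only the labels of vertices and of the edges joining a basic vertex to a vertex of $[n+1,n_1]$). -}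

module Defs where

open import Data.Nat using (ℕ; zero; suc; _*_; _<_; _≤_; _<ᵇ_)
open import Data.Nat.Properties using (_≟_)
open import Data.Fin using (Fin; toℕ)
import Data.Fin.Properties as FinP
open import Data.Fin.Permutation using (Permutation′; _⟨$⟩ʳ_)
open import Data.List using (List; map; concatMap; allFin; deduplicate; length)
open import Data.List.Relation.Binary.Permutation.Propositional using (_↭_)
open import Data.Product using (_×_; _,_; Σ; ∃; ∃-syntax)
open import Data.Sum using (_⊎_)
open import Data.Bool using (Bool; true; false; if_then_else_; _∧_)
open import Relation.Nullary using (¬_; does)
open import Relation.Binary.PropositionalEquality using (_≡_; _≢_)
open import Function.Bundles using (_⇔_)

-- Symbols.  The symbol set {x₀} ∪ Var is modelled by ℕ:
-- x₀ is 0 and Var is the (infinite) set of positive naturals.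

Symbol : Set
Symbol = ℕ

x₀ : Symbol
x₀ = 0

IsVar : Symbol → Set
IsVar s = s ≢ x₀

LGraph : ℕ → Set
LGraph n = Fin n → Fin n → Symbol

entries : ∀ {n} {A : Set} → (Fin n → Fin n → A) → List A
entries {n} M = concatMap (λ i → map (λ j → M i j) (allFin n)) (allFin n)

dim : ∀ {n} → LGraph n → ℕ
dim G = length (deduplicate _≟_ (entries G))

-- Diamond product:  (G ⋄ G)_ij = {{ (g_ik , g_kj) : k ∈ [n] }}
-- A multiset is represented by a list, multiset equality being _↭_.

_⋄_ : ∀ {n} → LGraph n → LGraph n → Fin n → Fin n → List (Symbol × Symbol)
_⋄_ {n} G H i j = map (λ k → (G i k , H k j)) (allFin n)

-- B is a (possible) value of evs(A): entries replaced by variables of Var,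
-- equal (as multisets) entries getting equal variables and distinct ones
-- distinct variables.
IsEvs : ∀ {n} → (Fin n → Fin n → List (Symbol × Symbol)) → LGraph n → Set
IsEvs {n} A B =
  (∀ (i j k l : Fin n) → (A i j ↭ A k l) ⇔ (B i j ≡ B k l)) ×
  (∀ (i j : Fin n) → IsVar (B i j))

_≥ₘ_ : ∀ {n} → LGraph n → LGraph n → Set
_≥ₘ_ {n} A B = ∀ (u v s t : Fin n) → B u v ≡ B s t → A u v ≡ A s t

_≈ₘ_ : ∀ {n} → LGraph n → LGraph n → Set
A ≈ₘ B = (A ≥ₘ B) × (B ≥ₘ A)

IsWLStart : ∀ {n} → LGraph n → LGraph n → Set
IsWLStart {n} G G₁ =
  (∀ (i j : Fin n) → i ≢ j → G₁ i j ≡ G i j) ×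
  (∀ (i j : Fin n) → (G₁ i i ≡ G₁ j j) ⇔ (G i i ≡ G j j)) ×
  (∀ (i : Fin n) → IsVar (G₁ i i)) ×
  (∀ (i k l : Fin n) → k ≢ l → G₁ i i ≢ G₁ k l)

-- IsWL G M : M is a representative of wl(G).  The run of the algorithm is
-- H 0 = G₁, H 1 = G₂, … ; it stops at the first t with
-- dim (H t) = dim (H (t+1)), and wl(G) = H t.
IsWL : ∀ {n} → LGraph n → LGraph n → Set
IsWL {n} G M =
  ∃[ t ] Σ (ℕ → LGraph n) λ H →
    IsWLStart G (H 0) ×
    (∀ s → IsEvs (H s ⋄ H s) (H (suc s))) ×
    (∀ s → s < t → dim (H s) ≢ dim (H (suc s))) ×
    dim (H t) ≡ dim (H (suc t)) ×
    (∀ (i j : Fin n) → M i j ≡ H t i j)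

IsAut : ∀ {n} → LGraph n → Permutation′ n → Set
IsAut {n} G σ = ∀ (i j : Fin n) → G i j ≡ G (σ ⟨$⟩ʳ i) (σ ⟨$⟩ʳ j)

SameAut : ∀ {n} → LGraph n → LGraph n → Set
SameAut {n} A B = ∀ (σ : Permutation′ n) → IsAut A σ ⇔ IsAut B σ

IsSimple : ∀ {n} → LGraph n → Set
IsSimple {n} G =
  (∀ (i j : Fin n) → G i j ≡ G j i) ×
  dim G ≤ 2 ×
  (∀ (i : Fin n) → G i i ≡ x₀)

-- vertex i (0-indexed) is basic iff i ∈ [n] (1-indexed), i.e. toℕ i < n
Basic : ∀ (n : ℕ) {m} → Fin m → Set
Basic n i = toℕ i < n

NeighboursExactly : ∀ {m} → LGraph m → Fin m → Fin m → Fin m → Set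
NeighboursExactly {m} G w u v =
  ∀ (j : Fin m) → j ≢ w → (G w j ≢ x₀) ⇔ (j ≡ u ⊎ j ≡ v)

IsWedge : ∀ (n : ℕ) {m} → LGraph m → Fin m → Fin m → Fin m → Set
IsWedge n G u v w = n ≤ toℕ w × NeighboursExactly G w u v

IsBindingGraph : ∀ (n : ℕ) {m} → LGraph m → Set
IsBindingGraph n {m} G =
  IsSimple G ×
  (∀ (u v : Fin m) → Basic n u → Basic n v → u ≢ v →
     ∃[ w ] (IsWedge n G u v w × (∀ w′ → IsWedge n G u v w′ → w′ ≡ w))) ×
  (∀ (u v u′ v′ w w′ : Fin m) →
     Basic n u → Basic n v → u ≢ v →
     Basic n u′ → Basic n v′ → u′ ≢ v′ →
     IsWedge n G u v w → IsWedge n G u′ v′ w′ →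
     ¬ ((u ≡ u′ × v ≡ v′) ⊎ (u ≡ v′ × v ≡ u′)) → w ≢ w′)

phiGraph : ∀ (n : ℕ) {m} → LGraph m → LGraph m → LGraph m
phiGraph n G M i j =
  if does (i FinP.≟ j) then M i j
  else if does (G i j ≟ x₀) then x₀
  else if (toℕ i <ᵇ n) ∧ (toℕ j <ᵇ n) then x₀
  else M i j

{-# OPTIONS --safe #-}

-- Let M = wl([G]) and W = wl(Φ). A WL representative of X is the coarsest matrix with separated
-- diagonal that refines X and is stable (equal colours have equal diamond rows), and it has the
-- automorphisms of X; so it suffices to show that M refines Φ and that W refines [G].
-- Φ differs from [G] only by erasing the edges between basic vertices. M still tells them apart
-- because its diagonal determines degrees: a basic vertex with a basic neighbour has degree at
-- least 3 (as n > 2), while, since n₁ = n + n(n-1)/2, every other vertex is a wedge u ∧ v of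
-- degree 2. Conversely W recovers a basic edge ij from the path i, i ∧ j, j, whose edges Φ keeps:
-- stability of W moves it to a path k, q, l through a wedge q, and stability of M then forces
-- kl to be an edge of [G].

module Submission where

open import Defs
open import Data.Nat using (ℕ; zero; suc; _+_; _*_; _≤_; _<_; z≤n; s≤s; _<?_; _<ᵇ_)
open import Data.Nat.DivMod using (_/_; m*n/n≡m)
open import Data.Nat.Tactic.RingSolver using (solve)
open import Data.Nat.Properties
  using (_≟_; <-irrefl; <-asym; <⇒≱; n<1+n; m≤m+n; +-monoʳ-<; module ≤-Reasoning)
open import Data.Fin using (Fin; zero; suc; toℕ; inject≤)
import Data.Fin.Properties as FinP
open import Data.Fin.Permutation using (Permutation′; _⟨$⟩ʳ_; _⟨$⟩ˡ_; inverseʳ)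
open import Data.List using (List; []; _∷_; _++_; map; length; allFin; filter; cartesianProduct; deduplicate)
open import Data.List.Properties using (map-∘; map-cong; length-map; length-++; length-tabulate; filter-≐)
open import Data.List.Membership.Propositional using (_∈_; _∉_; find; lose)
open import Data.List.Membership.Propositional.Properties
  using ( ∈-∃++; ∈-map⁺; ∈-map⁻; ∈-++⁻; ∈-filter⁺; ∈-filter⁻; ∈-allFin; ∈-cartesianProduct⁺
        ; ∈-deduplicate⁺; deduplicate-∈⇔; ∈-concatMap⁺; ∈-concatMap⁻)
open import Data.List.Membership.Propositional.Properties.WithK using (unique∧set⇒bag)
open import Data.List.Membership.DecPropositional _≟_ using (_∈?_)
open import Data.List.Relation.Binary.BagAndSetEquality using (∼bag⇒↭)
open import Data.List.Relation.Binary.Subset.Propositional using (_⊆_)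
open import Data.List.Relation.Binary.Permutation.Propositional using (_↭_; ↭-sym; ↭-trans; ↭-reflexive)
open import Data.List.Relation.Binary.Permutation.Propositional.Properties
  using (↭-length; shift; ∈-resp-↭; filter-↭)
  renaming (map⁺ to ↭-map⁺)
open import Data.List.Relation.Unary.Any using (Any; here; there; satisfied; any?)
import Data.List.Relation.Unary.Any as Any
import Data.List.Relation.Unary.All as All
import Data.List.Relation.Unary.All.Properties as AllP
open import Data.List.Relation.Unary.AllPairs using (_∷_; [])
open import Data.List.Relation.Unary.Unique.Propositional using (Unique)
import Data.List.Relation.Unary.Unique.Propositional.Properties as Unique
open import Data.List.Relation.Unary.Unique.DecPropositional.Properties _≟_ using (deduplicate-!)
open import Data.Product using (_×_; _,_; proj₁; proj₂; ∃; ∃₂; Σ)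
import Data.Product as Prod
open import Data.Product.Properties using (≡-dec)
open import Data.Sum using (_⊎_; inj₁; inj₂)
open import Data.Bool using (true; false)
open import Data.Empty using (⊥; ⊥-elim)
open import Function using (_∘_; _$_; id; case_of_; Injection)
open import Function.Bundles using (_⇔_; mk⇔; Equivalence)
open import Function.Properties.Inverse using (Inverse⇒Injection)
open import Relation.Nullary using (¬_; ¬?; Dec; yes; no; does; contradiction)
open import Relation.Nullary.Decidable using (dec-true; dec-false; _×-dec_)
open import Relation.Unary using (Decidable; _≐_)
open import Relation.Binary.PropositionalEquality
open import Relation.Binary.Definitions using (DecidableEquality)

open Equivalence using (to; from)

private variable
  A B : Set
  m : ℕ

unique-⊆⇒length≤ : {xs ys : List A} → Unique xs → xs ⊆ ys → length xs ≤ length ys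
unique-⊆⇒length≤ {xs = []} _ _ = z≤n
unique-⊆⇒length≤ {xs = x ∷ xs} (x∉xs ∷ xs!) x∷xs⊆ys
  with as , bs , refl ← ∈-∃++ (x∷xs⊆ys (here refl)) = begin
    suc (length xs)          ≤⟨ s≤s (unique-⊆⇒length≤ xs! xs⊆as++bs) ⟩
    suc (length (as ++ bs))  ≡⟨ ↭-length (shift x as bs) ⟨
    length (as ++ x ∷ bs)    ∎
  where
  open ≤-Reasoning
  xs⊆as++bs : xs ⊆ as ++ bs
  xs⊆as++bs y∈xs with ∈-resp-↭ (shift x as bs) (x∷xs⊆ys (there y∈xs))
  ... | here refl = ⊥-elim (All.lookup x∉xs y∈xs refl)
  ... | there y∈as++bs = y∈as++bs

unique-⊆-∌⇒length< : {xs ys : List A} {z : A} →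
  Unique xs → xs ⊆ ys → z ∈ ys → z ∉ xs → length xs < length ys
unique-⊆-∌⇒length< xs! xs⊆ys z∈ys z∉xs =
  unique-⊆⇒length≤ (All.tabulate (λ { y∈xs refl → z∉xs y∈xs }) ∷ xs!)
                   (λ { (here refl) → z∈ys ; (there y∈xs) → xs⊆ys y∈xs })

unique-map⁺-injectiveOn : (f : A → B) {xs : List A} → Unique xs →
  (∀ {x y} → x ∈ xs → y ∈ xs → f x ≡ f y → x ≡ y) → Unique (map f xs)
unique-map⁺-injectiveOn f {[]} [] _ = []
unique-map⁺-injectiveOn f {x ∷ xs} (x∉xs ∷ xs!) inj =
  AllP.map⁺ (All.tabulate λ y∈xs fx≡fy → All.lookup x∉xs y∈xs (inj (here refl) (there y∈xs) fx≡fy))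
  ∷ unique-map⁺-injectiveOn f xs! (λ x∈xs y∈xs → inj (there x∈xs) (there y∈xs))

filter-map : {P : B → Set} (P? : Decidable P) (f : A → B) (xs : List A) →
  filter P? (map f xs) ≡ map f (filter (P? ∘ f) xs)
filter-map P? f [] = refl
filter-map P? f (x ∷ xs) with does (P? (f x))
... | true = cong (f x ∷_) (filter-map P? f xs)
... | false = filter-map P? f xs

⟨$⟩ʳ-injective : (σ : Permutation′ m) {i j : Fin m} → σ ⟨$⟩ʳ i ≡ σ ⟨$⟩ʳ j → i ≡ j
⟨$⟩ʳ-injective σ = Injection.injective (Inverse⇒Injection σ)

allFin-↭-permute : (σ : Permutation′ m) → allFin m ↭ map (σ ⟨$⟩ʳ_) (allFin m)
allFin-↭-permute {m} σ =
  ∼bag⇒↭ (unique∧set⇒bag (Unique.allFin⁺ m) (Unique.map⁺ (⟨$⟩ʳ-injective σ) (Unique.allFin⁺ m))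
            λ {i} → mk⇔ (λ _ → subst (_∈ map (σ ⟨$⟩ʳ_) (allFin m)) (inverseʳ σ)
                                       (∈-map⁺ (σ ⟨$⟩ʳ_) (∈-allFin (σ ⟨$⟩ˡ i))))
                        (λ _ → ∈-allFin i))

map-allFin-↭-permute : (σ : Permutation′ m) (f : Fin m → A) →
  map f (allFin m) ↭ map (f ∘ (σ ⟨$⟩ʳ_)) (allFin m)
map-allFin-↭-permute {m} σ f = ↭-trans (↭-map⁺ f (allFin-↭-permute σ)) (↭-reflexive (sym (map-∘ (allFin m))))

-- Refinement of colourings

≥ₘ-trans : {A B C : LGraph m} → A ≥ₘ B → B ≥ₘ C → A ≥ₘ C
≥ₘ-trans A≥B B≥C u v s t = A≥B u v s t ∘ B≥C u v s t

≗⇒≥ₘ : {A B : LGraph m} → (∀ i j → A i j ≡ B i j) → A ≥ₘ B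
≗⇒≥ₘ A≗B u v s t Buv≡Bst = trans (A≗B u v) (trans Buv≡Bst (sym (A≗B s t)))

≥ₘ⇒isAut : {A B : LGraph m} {σ : Permutation′ m} → A ≥ₘ B → IsAut B σ → IsAut A σ
≥ₘ⇒isAut A≥B aut i j = A≥B _ _ _ _ (aut i j)

≈ₘ⇒sameAut : {A B : LGraph m} → A ≈ₘ B → SameAut A B
≈ₘ⇒sameAut {A = A} {B} (A≥B , B≥A) σ =
  mk⇔ (≥ₘ⇒isAut {A = B} {A} {σ} B≥A) (≥ₘ⇒isAut {A = A} {B} {σ} A≥B)

sameAut-sym : {A B : LGraph m} → SameAut A B → SameAut B A
sameAut-sym A~B σ = mk⇔ (from (A~B σ)) (to (A~B σ))

-- The Z-colour at the first position of Y-colour c, and x₀ if c does not occur in Y.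
recolourOn : LGraph m → LGraph m → List (Fin m × Fin m) → Symbol → Symbol
recolourOn Y Z [] c = x₀
recolourOn Y Z ((p , q) ∷ ps) c with Y p q ≟ c
... | yes _ = Z p q
... | no _ = recolourOn Y Z ps c

recolourOn-spec : (Y Z : LGraph m) {ps : List (Fin m × Fin m)} {i j : Fin m} → (i , j) ∈ ps →
  ∃₂ λ p q → Y p q ≡ Y i j × recolourOn Y Z ps (Y i j) ≡ Z p q
recolourOn-spec Y Z {(p , q) ∷ ps} {i} {j} i,j∈ with Y p q ≟ Y i j
... | yes Ypq≡Yij = p , q , Ypq≡Yij , refl
recolourOn-spec Y Z (here refl) | no Yij≢Yij = contradiction refl Yij≢Yij
recolourOn-spec Y Z (there i,j∈ps) | no _ = recolourOn-spec Y Z i,j∈ps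

recolour : LGraph m → LGraph m → Symbol → Symbol
recolour {m} Y Z = recolourOn Y Z (cartesianProduct (allFin m) (allFin m))

recolour-spec : (Y Z : LGraph m) (i j : Fin m) →
  ∃₂ λ p q → Y p q ≡ Y i j × recolour Y Z (Y i j) ≡ Z p q
recolour-spec Y Z i j = recolourOn-spec Y Z (∈-cartesianProduct⁺ (∈-allFin i) (∈-allFin j))

≥ₘ⇒recolour : {Y Z : LGraph m} → Z ≥ₘ Y → ∀ i j → Z i j ≡ recolour Y Z (Y i j)
≥ₘ⇒recolour {Y = Y} {Z} Z≥Y i j with p , q , Ypq≡Yij , eq ← recolour-spec Y Z i j =
  trans (Z≥Y i j p q (sym Ypq≡Yij)) (sym eq)

colours : LGraph m → List Symbol
colours A = deduplicate _≟_ (entries A)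

∈-colours : (A : LGraph m) (i j : Fin m) → A i j ∈ colours A
∈-colours {m} A i j = ∈-deduplicate⁺ _≟_
  (∈-concatMap⁺ (λ i → map (A i) (allFin m))
                (Any.map (λ { refl → ∈-map⁺ (A i) (∈-allFin j) }) (∈-allFin i)))

colours-∈ : (A : LGraph m) {x : Symbol} → x ∈ colours A → ∃₂ λ i j → x ≡ A i j
colours-∈ {m} A x∈
  with i , x∈row ← satisfied (∈-concatMap⁻ (λ i → map (A i) (allFin m)) {xs = allFin m}
                                           (from (deduplicate-∈⇔ _≟_) x∈))
  with j , _ , x≡Aij ← ∈-map⁻ (A i) x∈row = i , j , x≡Aij

-- If B separated two positions that A identifies, g = recolour A B would map the colours of A
-- injectively into those of B and miss one of them, so dim A < dim B.
≥ₘ∧dim≡⇒≈ₘ : {A B : LGraph m} → A ≥ₘ B → dim A ≡ dim B → A ≈ₘ B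
≥ₘ∧dim≡⇒≈ₘ {A = A} {B} A≥B dimA≡dimB = A≥B , B≥A
  where
  g : Symbol → Symbol
  g = recolour A B

  image : List Symbol
  image = map g (colours A)

  g-spec : ∀ {x} → x ∈ colours A → ∃₂ λ p q → A p q ≡ x × g x ≡ B p q
  g-spec x∈ with i , j , refl ← colours-∈ A x∈ = recolour-spec A B i j

  g-injective : ∀ {x y} → x ∈ colours A → y ∈ colours A → g x ≡ g y → x ≡ y
  g-injective x∈ y∈ gx≡gy
    with p , q , refl , gx≡Bpq ← g-spec x∈ | p′ , q′ , refl , gy≡Bp′q′ ← g-spec y∈ =
    A≥B p q p′ q′ (trans (sym gx≡Bpq) (trans gx≡gy gy≡Bp′q′))

  image⊆colours : image ⊆ colours B
  image⊆colours z∈ with x , x∈ , refl ← ∈-map⁻ g z∈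
    with p , q , _ , gx≡Bpq ← g-spec x∈ =
    subst (_∈ colours B) (sym gx≡Bpq) (∈-colours B p q)

  ∈-image : ∀ {p q} → B p q ∈ image → B p q ≡ g (A p q)
  ∈-image {p} {q} Bpq∈ with x , x∈ , Bpq≡gx ← ∈-map⁻ g Bpq∈
    with p′ , q′ , refl , gx≡Bp′q′ ← g-spec x∈ =
    trans Bpq≡gx (cong g (A≥B p′ q′ p q (trans (sym gx≡Bp′q′) (sym Bpq≡gx))))

  colours⊆image : ∀ {z} → z ∈ colours B → z ∈ image
  colours⊆image {z} z∈ with z ∈? image
  ... | yes z∈image = z∈image
  ... | no z∉image = ⊥-elim (<-irrefl dimA≡dimB
          (subst (_< dim B) (length-map g (colours A))
                 (unique-⊆-∌⇒length< (unique-map⁺-injectiveOn g (deduplicate-! _) g-injective)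
                                     image⊆colours z∈ z∉image)))

  B≥A : B ≥ₘ A
  B≥A u v s t Auv≡Ast = begin
    B u v      ≡⟨ ∈-image (colours⊆image (∈-colours B u v)) ⟩
    g (A u v)  ≡⟨ cong g Auv≡Ast ⟩
    g (A s t)  ≡⟨ ∈-image (colours⊆image (∈-colours B s t)) ⟨
    B s t      ∎
    where open ≡-Reasoning

-- Stability and the Weisfeiler–Leman run

DiagonalSeparated : LGraph m → Set
DiagonalSeparated {m} H = ∀ (i k l : Fin m) → H k l ≡ H i i → k ≡ l

Stable : LGraph m → Set
Stable {m} H = ∀ (i j k l : Fin m) → H i j ≡ H k l → (H ⋄ H) i j ↭ (H ⋄ H) k l

module _ {H : LGraph m} where

  ↭-⋄-path : ∀ {i j k l} → (H ⋄ H) i j ↭ (H ⋄ H) k l →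
    ∀ p → ∃ λ q → H i p ≡ H k q × H p j ≡ H q l
  ↭-⋄-path {i} {j} {k} {l} ⋄↭⋄ p
    with q , _ , eq ← ∈-map⁻ (λ q → H k q , H q l)
                             (∈-resp-↭ ⋄↭⋄ (∈-map⁺ (λ q → H i q , H q j) (∈-allFin p))) =
    q , cong proj₁ eq , cong proj₂ eq

  ↭-⋄⇒≡ : DiagonalSeparated H → ∀ {i j k l} → (H ⋄ H) i j ↭ (H ⋄ H) k l → H i j ≡ H k l
  ↭-⋄⇒≡ sep {j = j} ⋄↭⋄ with q , Hij≡Hkq , Hjj≡Hql ← ↭-⋄-path ⋄↭⋄ j
    with refl ← sep j q _ (sym Hjj≡Hql) = Hij≡Hkq

  stable-path : Stable H → ∀ {i j k l} → H i j ≡ H k l →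
    ∀ p → ∃ λ q → H i p ≡ H k q × H p j ≡ H q l
  stable-path st Hij≡Hkl = ↭-⋄-path (st _ _ _ _ Hij≡Hkl)

  stable-diagonal : DiagonalSeparated H → Stable H → ∀ {i j k l} → H i j ≡ H k l →
    H i i ≡ H k k × H j j ≡ H l l
  stable-diagonal sep st {i} {j} {k} {l} Hij≡Hkl
    with q , Hii≡Hkq , _ ← stable-path st Hij≡Hkl i | q′ , _ , Hjj≡Hq′l ← stable-path st Hij≡Hkl j
    with refl ← sep i k q (sym Hii≡Hkq) | refl ← sep j q′ l (sym Hjj≡Hq′l) = Hii≡Hkq , Hjj≡Hq′l

  separated-offDiagonal : DiagonalSeparated H → ∀ {i j k l} → i ≢ j → H i j ≡ H k l → k ≢ l
  separated-offDiagonal sep {i} {j} {k} i≢j Hij≡Hkk refl = i≢j (sep k i j Hij≡Hkk)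

  isAut⇒↭-⋄ : {σ : Permutation′ m} → IsAut H σ → ∀ i j →
    (H ⋄ H) i j ↭ (H ⋄ H) (σ ⟨$⟩ʳ i) (σ ⟨$⟩ʳ j)
  isAut⇒↭-⋄ {σ} aut i j = ↭-sym (↭-trans
    (map-allFin-↭-permute σ (λ k → H (σ ⟨$⟩ʳ i) k , H k (σ ⟨$⟩ʳ j)))
    (↭-reflexive (map-cong (λ k → sym (cong₂ _,_ (aut i k) (aut k j))) (allFin m))))

≥ₘ-separated : {A B : LGraph m} → A ≥ₘ B → DiagonalSeparated A → DiagonalSeparated B
≥ₘ-separated A≥B sep i k l Bkl≡Bii = sep i k l (A≥B k l i i Bkl≡Bii)

≥ₘ-byDiagonal : {A B : LGraph m} → DiagonalSeparated B →
  (∀ i k → B i i ≡ B k k → A i i ≡ A k k) →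
  (∀ i j k l → i ≢ j → k ≢ l → B i j ≡ B k l → A i j ≡ A k l) →
  A ≥ₘ B
≥ₘ-byDiagonal sep diagonal offDiagonal i j k l Bij≡Bkl with i FinP.≟ j | k FinP.≟ l
... | yes refl | yes refl = diagonal i k Bij≡Bkl
... | no i≢j   | no k≢l   = offDiagonal i j k l i≢j k≢l Bij≡Bkl
... | yes refl | no k≢l   = contradiction (sep i k l (sym Bij≡Bkl)) k≢l
... | no i≢j   | yes refl = contradiction (sep k i j Bij≡Bkl) i≢j

-- A coarsening of a stable matrix Y is a function of the Y-colours, hence so are its diamond rows.
stable-coarsening : {Y Z : LGraph m} → Stable Y → Z ≥ₘ Y →
  ∀ {i j k l} → Y i j ≡ Y k l → (Z ⋄ Z) i j ↭ (Z ⋄ Z) k l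
stable-coarsening {m} {Y} {Z} st Z≥Y {i} {j} {k} {l} Yij≡Ykl =
  subst₂ _↭_ (recolour-⋄ i j) (recolour-⋄ k l) (↭-map⁺ recolour² (st i j k l Yij≡Ykl))
  where
  recolour² : Symbol × Symbol → Symbol × Symbol
  recolour² (a , b) = recolour Y Z a , recolour Y Z b

  recolour-⋄ : ∀ i j → map recolour² ((Y ⋄ Y) i j) ≡ (Z ⋄ Z) i j
  recolour-⋄ i j = trans (sym (map-∘ (allFin m)))
    (map-cong (λ q → sym (cong₂ _,_ (≥ₘ⇒recolour Z≥Y i q) (≥ₘ⇒recolour Z≥Y q j))) (allFin m))

module WLRun {X : LGraph m} {H : ℕ → LGraph m}
             (start : IsWLStart X (H 0)) (step : ∀ s → IsEvs (H s ⋄ H s) (H (suc s))) where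

  private
    start-offDiagonal : ∀ i j → i ≢ j → H 0 i j ≡ X i j
    start-offDiagonal = proj₁ start

    start-diagonal : ∀ i k → (H 0 i i ≡ H 0 k k) ⇔ (X i i ≡ X k k)
    start-diagonal = proj₁ (proj₂ start)

    step-↭ : ∀ s {i j k l} → H (suc s) i j ≡ H (suc s) k l → (H s ⋄ H s) i j ↭ (H s ⋄ H s) k l
    step-↭ s = from (proj₁ (step s) _ _ _ _)

    ↭-step : ∀ s {i j k l} → (H s ⋄ H s) i j ↭ (H s ⋄ H s) k l → H (suc s) i j ≡ H (suc s) k l
    ↭-step s = to (proj₁ (step s) _ _ _ _)

  start-separated : DiagonalSeparated (H 0)
  start-separated i k l Hkl≡Hii with k FinP.≟ l
  ... | yes k≡l = k≡l
  ... | no k≢l = contradiction (sym Hkl≡Hii) (proj₂ (proj₂ (proj₂ start)) i k l k≢l)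

  step-refines : ∀ s → DiagonalSeparated (H s) → H s ≥ₘ H (suc s)
  step-refines s sep i j k l = ↭-⋄⇒≡ sep ∘ step-↭ s

  separated : ∀ s → DiagonalSeparated (H s)
  separated zero = start-separated
  separated (suc s) = ≥ₘ-separated (step-refines s (separated s)) (separated s)

  refines : ∀ s → X ≥ₘ H s
  refines zero = ≥ₘ-byDiagonal start-separated (λ i k → to (start-diagonal i k))
    λ i j k l i≢j k≢l H₀ij≡H₀kl →
      trans (sym (start-offDiagonal i j i≢j)) (trans H₀ij≡H₀kl (start-offDiagonal k l k≢l))
  refines (suc s) = ≥ₘ-trans (refines s) (step-refines s (separated s))

  stable-at : ∀ t → dim (H t) ≡ dim (H (suc t)) → Stable (H t)
  stable-at t dim≡ i j k l =
    step-↭ t ∘ proj₂ (≥ₘ∧dim≡⇒≈ₘ (step-refines t (separated t)) dim≡) i j k l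

  refines-stable : {Y : LGraph m} → DiagonalSeparated Y → Stable Y → X ≥ₘ Y → ∀ s → H s ≥ₘ Y
  refines-stable sepY _ X≥Y zero = ≥ₘ-byDiagonal sepY (λ i k → from (start-diagonal i k) ∘ X≥Y i i k k)
    λ i j k l i≢j k≢l Yij≡Ykl →
      trans (start-offDiagonal i j i≢j) (trans (X≥Y i j k l Yij≡Ykl) (sym (start-offDiagonal k l k≢l)))
  refines-stable sepY stY X≥Y (suc s) i j k l =
    ↭-step s ∘ stable-coarsening stY (refines-stable sepY stY X≥Y s)

  preserves-isAut : {σ : Permutation′ m} → IsAut X σ → ∀ s → IsAut (H s) σ
  preserves-isAut {σ} aut zero i j with i FinP.≟ j
  ... | yes refl = from (start-diagonal i (σ ⟨$⟩ʳ i)) (aut i i)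
  ... | no i≢j = trans (start-offDiagonal i j i≢j)
                   (trans (aut i j) (sym (start-offDiagonal _ _ (i≢j ∘ ⟨$⟩ʳ-injective σ))))
  preserves-isAut {σ} aut (suc s) i j = ↭-step s (isAut⇒↭-⋄ {H = H s} {σ} (preserves-isAut {σ} aut s) i j)

  preserves-edges : ∀ s {i j} → X i j ≢ x₀ → H s i j ≢ x₀
  preserves-edges zero {i} {j} Xij≢x₀ with i FinP.≟ j
  ... | yes refl = proj₁ (proj₂ (proj₂ start)) i
  ... | no i≢j = Xij≢x₀ ∘ trans (sym (start-offDiagonal i j i≢j))
  preserves-edges (suc s) _ = proj₂ (step s) _ _

module _ {X M : LGraph m} where

  wl-refines : IsWL X M → X ≥ₘ M
  wl-refines (t , _ , start , step , _ , _ , M≗Hₜ) =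
    ≥ₘ-trans (WLRun.refines start step t) (≗⇒≥ₘ (λ i j → sym (M≗Hₜ i j)))

  wl-separated : IsWL X M → DiagonalSeparated M
  wl-separated (t , _ , start , step , _ , _ , M≗Hₜ) =
    ≥ₘ-separated (≗⇒≥ₘ (λ i j → sym (M≗Hₜ i j))) (WLRun.separated start step t)

  wl-stable : IsWL X M → Stable M
  wl-stable (t , _ , start , step , _ , dim≡ , M≗Hₜ) i j k l =
    stable-coarsening (WLRun.stable-at start step t dim≡) (≗⇒≥ₘ M≗Hₜ)
    ∘ ≗⇒≥ₘ (λ i j → sym (M≗Hₜ i j)) i j k l

  wl-coarsest : IsWL X M → {Y : LGraph m} → DiagonalSeparated Y → Stable Y → X ≥ₘ Y → M ≥ₘ Y
  wl-coarsest (t , _ , start , step , _ , _ , M≗Hₜ) sepY stY X≥Y =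
    ≥ₘ-trans (≗⇒≥ₘ M≗Hₜ) (WLRun.refines-stable start step sepY stY X≥Y t)

  wl-sameAut : IsWL X M → SameAut X M
  wl-sameAut wl@(t , H , start , step , _ , _ , M≗Hₜ) σ =
    mk⇔ (≥ₘ⇒isAut {A = M} {H t} {σ} (≗⇒≥ₘ M≗Hₜ) ∘ λ aut → WLRun.preserves-isAut start step {σ} aut t)
        (≥ₘ⇒isAut {A = X} {M} {σ} (wl-refines wl))

  wl-preserves-edges : IsWL X M → ∀ {i j} → X i j ≢ x₀ → M i j ≢ x₀
  wl-preserves-edges (t , _ , start , step , _ , _ , M≗Hₜ) {i} {j} Xij≢x₀ =
    WLRun.preserves-edges start step t Xij≢x₀ ∘ trans (sym (M≗Hₜ i j))

adjacent? : (X : LGraph m) (i : Fin m) → Decidable (λ j → X i j ≢ x₀)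
adjacent? X i j = ¬? (X i j ≟ x₀)

degree : LGraph m → Fin m → ℕ
degree {m} X i = length (filter (adjacent? X i) (allFin m))

degree≤ : {X : LGraph m} {i : Fin m} {js : List (Fin m)} →
  (∀ {j} → X i j ≢ x₀ → j ∈ js) → degree X i ≤ length js
degree≤ {m} {X} {i} neighbours =
  unique-⊆⇒length≤ (Unique.filter⁺ (adjacent? X i) (Unique.allFin⁺ m))
                   (neighbours ∘ proj₂ ∘ ∈-filter⁻ (adjacent? X i) {xs = allFin m})

≤degree : {X : LGraph m} {i : Fin m} {js : List (Fin m)} →
  Unique js → (∀ {j} → j ∈ js → X i j ≢ x₀) → length js ≤ degree X i
≤degree {X = X} {i} js! adjacent =
  unique-⊆⇒length≤ js! (λ j∈js → ∈-filter⁺ (adjacent? X i) (∈-allFin _) (adjacent j∈js))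

-- Whether X i j is an edge is a function of M i j, and these colours are the first
-- components of the diamond row (M ⋄ M) i i.
stable-degree : {X M : LGraph m} → X ≥ₘ M → Stable M →
  ∀ {i k} → M i i ≡ M k k → degree X i ≡ degree X k
stable-degree {m} {X} {M} X≥M st {i} {k} Mii≡Mkk = begin
  degree X i                                  ≡⟨ degree-⋄ i ⟩
  length (filter colourOfEdge? ((M ⋄ M) i i)) ≡⟨ ↭-length (filter-↭ colourOfEdge? (st i i k k Mii≡Mkk)) ⟩
  length (filter colourOfEdge? ((M ⋄ M) k k)) ≡⟨ degree-⋄ k ⟨
  degree X k                                  ∎
  where
  open ≡-Reasoning

  colourOfEdge? : (c : Symbol × Symbol) → Dec (recolour M X (proj₁ c) ≢ x₀)
  colourOfEdge? (a , _) = ¬? (recolour M X a ≟ x₀)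

  degree-⋄ : ∀ i → degree X i ≡ length (filter colourOfEdge? ((M ⋄ M) i i))
  degree-⋄ i = begin
    degree X i                                  ≡⟨ cong length (filter-≐ _ _ adjacent⇔ (allFin m)) ⟩
    length neighbours                           ≡⟨ length-map row neighbours ⟨
    length (map row neighbours)                 ≡⟨ cong length (filter-map colourOfEdge? row (allFin m)) ⟨
    length (filter colourOfEdge? ((M ⋄ M) i i)) ∎
    where
    row : Fin m → Symbol × Symbol
    row j = M i j , M j i

    neighbours : List (Fin m)
    neighbours = filter (colourOfEdge? ∘ row) (allFin m)

    X≡ : ∀ j → X i j ≡ recolour M X (M i j)
    X≡ = ≥ₘ⇒recolour X≥M i

    adjacent⇔ : (λ j → X i j ≢ x₀) ≐ (λ j → recolour M X (M i j) ≢ x₀)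
    adjacent⇔ = (λ ne → ne ∘ trans (X≡ _)) , (λ ne → ne ∘ trans (sym (X≡ _)))

-- Binding graphs

choose2 : ℕ → ℕ
choose2 zero = 0
choose2 (suc n) = n + choose2 n

n*[1+n]≡[n+choose2]*2 : ∀ n → n * suc n ≡ (n + choose2 n) * 2
n*[1+n]≡[n+choose2]*2 zero = refl
n*[1+n]≡[n+choose2]*2 (suc n) = begin
  suc n * suc (suc n)               ≡⟨ solve (n ∷ []) ⟩
  n * suc n + 2 * suc n             ≡⟨ cong (_+ 2 * suc n) (n*[1+n]≡[n+choose2]*2 n) ⟩
  (n + choose2 n) * 2 + 2 * suc n   ≡⟨ regroup (choose2 n) ⟩
  (suc n + (n + choose2 n)) * 2     ∎
  where
  open ≡-Reasoning
  regroup : ∀ c → (n + c) * 2 + 2 * suc n ≡ (suc n + (n + c)) * 2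
  regroup c = solve (n ∷ c ∷ [])

n*[1+n]/2≡n+choose2 : ∀ n → n * suc n / 2 ≡ n + choose2 n
n*[1+n]/2≡n+choose2 n = trans (cong (_/ 2) (n*[1+n]≡[n+choose2]*2 n)) (m*n/n≡m (n + choose2 n) 2)

increasingPairs : ∀ n → List (Fin n × Fin n)
increasingPairs zero = []
increasingPairs (suc n) = map (λ v → zero , suc v) (allFin n) ++ map (Prod.map suc suc) (increasingPairs n)

length-increasingPairs : ∀ n → length (increasingPairs n) ≡ choose2 n
length-increasingPairs zero = refl
length-increasingPairs (suc n) = trans (length-++ (map _ (allFin n)))
  (cong₂ _+_ (trans (length-map _ (allFin n)) (length-tabulate id))
             (trans (length-map _ (increasingPairs n)) (length-increasingPairs n)))

∈-increasingPairs⇒< : ∀ {n} {u v : Fin n} → (u , v) ∈ increasingPairs n → toℕ u < toℕ v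
∈-increasingPairs⇒< {suc n} uv∈ with ∈-++⁻ (map _ (allFin n)) uv∈
... | inj₁ uv∈first with _ , _ , refl ← ∈-map⁻ _ uv∈first = s≤s z≤n
... | inj₂ uv∈rest with _ , uv∈pairs , refl ← ∈-map⁻ _ uv∈rest = s≤s (∈-increasingPairs⇒< uv∈pairs)

increasingPairs-unique : ∀ n → Unique (increasingPairs n)
increasingPairs-unique zero = []
increasingPairs-unique (suc n) = Unique.++⁺
  (Unique.map⁺ (FinP.suc-injective ∘ cong proj₂) (Unique.allFin⁺ n))
  (Unique.map⁺ (λ eq → cong₂ _,_ (FinP.suc-injective (cong proj₁ eq)) (FinP.suc-injective (cong proj₂ eq)))
               (increasingPairs-unique n))
  λ (p∈first , p∈rest) → disjoint p∈first p∈rest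
  where
  disjoint : ∀ {p} → p ∈ map (λ v → zero , suc v) (allFin n) →
             p ∈ map (Prod.map suc suc) (increasingPairs n) → ⊥
  disjoint p∈first p∈rest
    with _ , _ , p≡first ← ∈-map⁻ _ p∈first | _ , _ , p≡rest ← ∈-map⁻ _ p∈rest =
    FinP.0≢1+n (trans (sym (cong proj₁ p≡first)) (cong proj₁ p≡rest))

three-distinct : ∀ {n} → 2 < n → Σ (Fin n × Fin n × Fin n) λ (a , b , c) → a ≢ b × a ≢ c × b ≢ c
three-distinct (s≤s (s≤s (s≤s _))) = (zero , suc zero , suc (suc zero)) , (λ ()) , (λ ()) , (λ ())

avoid-two : {P : A → Set} → DecidableEquality A → ∀ {a b c} → P a → P b → P c →
  a ≢ b → a ≢ c → b ≢ c → ∀ x y → ∃ λ z → P z × z ≢ x × z ≢ y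
avoid-two _≟_ {a} {b} {c} Pa Pb Pc a≢b a≢c b≢c x y with a ≟ x | a ≟ y | b ≟ x | b ≟ y
... | no a≢x   | no a≢y   | _        | _        = a , Pa , a≢x , a≢y
... | _        | _        | no b≢x   | no b≢y   = b , Pb , b≢x , b≢y
... | yes refl | _        | _        | yes refl = c , Pc , a≢c ∘ sym , b≢c ∘ sym
... | _        | yes refl | yes refl | _        = c , Pc , b≢c ∘ sym , a≢c ∘ sym
... | yes refl | _        | yes refl | _        = contradiction refl a≢b
... | _        | yes refl | _        | yes refl = contradiction refl a≢b

module BindingGraph (n : ℕ) {m : ℕ} (m≡ : m ≡ n + choose2 n) {G : LGraph m} (bg : IsBindingGraph n G) where

  G-symmetric : ∀ i j → G i j ≡ G j i
  G-symmetric = proj₁ (proj₁ bg)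

  G-loopless : ∀ i → G i i ≡ x₀
  G-loopless = proj₂ (proj₂ (proj₁ bg))

  private
    G-dim≤2 : dim G ≤ 2
    G-dim≤2 = proj₁ (proj₂ (proj₁ bg))

    wedges-distinct : ∀ {u v u′ v′ w w′} →
      Basic n u → Basic n v → u ≢ v → Basic n u′ → Basic n v′ → u′ ≢ v′ →
      IsWedge n G u v w → IsWedge n G u′ v′ w′ →
      ¬ ((u ≡ u′ × v ≡ v′) ⊎ (u ≡ v′ × v ≡ u′)) → w ≢ w′
    wedges-distinct = proj₂ (proj₂ bg) _ _ _ _ _ _

  wedge : ∀ {u v} → Basic n u → Basic n v → u ≢ v → ∃ (IsWedge n G u v)
  wedge bu bv u≢v = Prod.map₂ proj₁ (proj₁ (proj₂ bg) _ _ bu bv u≢v)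

  basic? : (i : Fin m) → Dec (Basic n i)
  basic? i = toℕ i <? n

  basic≢nonBasic : ∀ {i j : Fin m} → Basic n i → ¬ Basic n j → i ≢ j
  basic≢nonBasic bi ¬bj refl = ¬bj bi

  wedge-nonBasic : ∀ {u v w} → IsWedge n G u v w → ¬ Basic n w
  wedge-nonBasic (n≤w , _) w<n = <⇒≱ w<n n≤w

  wedge-neighbours : ∀ {u v w j} → IsWedge n G u v w → G w j ≢ x₀ → j ≡ u ⊎ j ≡ v
  wedge-neighbours {w = w} {j} (_ , neighbours) Gwj≢x₀ with j FinP.≟ w
  ... | yes refl = contradiction (G-loopless w) Gwj≢x₀
  ... | no j≢w = to (neighbours j j≢w) Gwj≢x₀

  wedge-adjacentˡ : ∀ {u v w} → IsWedge n G u v w → Basic n u → G u w ≢ x₀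
  wedge-adjacentˡ w-wedge@(_ , neighbours) bu =
    from (neighbours _ (basic≢nonBasic bu (wedge-nonBasic w-wedge))) (inj₁ refl) ∘ trans (G-symmetric _ _)

  wedge-adjacentʳ : ∀ {u v w} → IsWedge n G u v w → Basic n v → G w v ≢ x₀
  wedge-adjacentʳ w-wedge@(_ , neighbours) bv =
    from (neighbours _ (basic≢nonBasic bv (wedge-nonBasic w-wedge))) (inj₂ refl)

  degree-wedge : ∀ {u v w} → IsWedge n G u v w → degree G w ≤ 2
  degree-wedge {u} {v} {w} w-wedge =
    degree≤ {X = G} {w} {u ∷ v ∷ []} λ Gwj≢x₀ → case wedge-neighbours w-wedge Gwj≢x₀ of λ where
      (inj₁ refl) → here refl
      (inj₂ refl) → there (here refl)

  edges-sameLabel : ∀ {i j k l} → G i j ≢ x₀ → G k l ≢ x₀ → G i j ≡ G k l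
  edges-sameLabel {i} {j} {k} {l} Gij≢x₀ Gkl≢x₀ with G i j ≟ G k l
  ... | yes Gij≡Gkl = Gij≡Gkl
  ... | no Gij≢Gkl = contradiction G-dim≤2 (<⇒≱ three-labels)
    where
    three-labels : 3 ≤ dim G
    three-labels = unique-⊆⇒length≤ {xs = x₀ ∷ G i j ∷ G k l ∷ []}
      ((Gij≢x₀ ∘ sym All.∷ Gkl≢x₀ ∘ sym All.∷ All.[]) ∷ (Gij≢Gkl All.∷ All.[]) ∷ All.[] ∷ [])
      λ where
        (here refl) → subst (_∈ colours G) (G-loopless i) (∈-colours G i i)
        (there (here refl)) → ∈-colours G i j
        (there (there (here refl))) → ∈-colours G k l

  n≤m : n ≤ m
  n≤m = subst (n ≤_) (sym m≡) (m≤m+n n (choose2 n))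

  basic : Fin n → Fin m
  basic u = inject≤ u n≤m

  basic-isBasic : ∀ u → Basic n (basic u)
  basic-isBasic u = subst (_< n) (sym (FinP.toℕ-inject≤ u n≤m)) (FinP.toℕ<n u)

  basic-injective : ∀ {u v} → basic u ≡ basic v → u ≡ v
  basic-injective {u} {v} eq =
    FinP.toℕ-injective (trans (sym (FinP.toℕ-inject≤ u n≤m)) (trans (cong toℕ eq) (FinP.toℕ-inject≤ v n≤m)))

  -- The value at a pair u ≡ v is junk: wedgeOf is only applied to increasing pairs.
  wedgeOf : Fin n × Fin n → Fin m
  wedgeOf (u , v) with u FinP.≟ v
  ... | yes _ = basic u
  ... | no u≢v = proj₁ (wedge (basic-isBasic u) (basic-isBasic v) (u≢v ∘ basic-injective))

  wedgeOf-isWedge : ∀ {u v} → u ≢ v → IsWedge n G (basic u) (basic v) (wedgeOf (u , v))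
  wedgeOf-isWedge {u} {v} u≢v with u FinP.≟ v
  ... | yes u≡v = contradiction u≡v u≢v
  ... | no u≢v = proj₂ (wedge (basic-isBasic u) (basic-isBasic v) (u≢v ∘ basic-injective))

  increasing-notSwapped : ∀ {u v u′ v′} → toℕ u < toℕ v → toℕ u′ < toℕ v′ →
    ¬ (basic u ≡ basic v′ × basic v ≡ basic u′)
  increasing-notSwapped u<v u′<v′ (bu≡bv′ , bv≡bu′)
    with refl ← basic-injective bu≡bv′ | refl ← basic-injective bv≡bu′ = <-asym u<v u′<v′

  wedgeOf-injective : ∀ {u v u′ v′} → toℕ u < toℕ v → toℕ u′ < toℕ v′ →
    wedgeOf (u , v) ≡ wedgeOf (u′ , v′) → (u , v) ≡ (u′ , v′)
  wedgeOf-injective {u} {v} {u′} {v′} u<v u′<v′ eq with ≡-dec FinP._≟_ FinP._≟_ (u , v) (u′ , v′)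
  ... | yes uv≡u′v′ = uv≡u′v′
  ... | no uv≢u′v′ = contradiction eq (wedges-distinct
          (basic-isBasic u) (basic-isBasic v) (FinP.<⇒≢ u<v ∘ basic-injective)
          (basic-isBasic u′) (basic-isBasic v′) (FinP.<⇒≢ u′<v′ ∘ basic-injective)
          (wedgeOf-isWedge (FinP.<⇒≢ u<v)) (wedgeOf-isWedge (FinP.<⇒≢ u′<v′))
          λ where
            (inj₁ (bu≡bu′ , bv≡bv′)) →
              uv≢u′v′ (cong₂ _,_ (basic-injective bu≡bu′) (basic-injective bv≡bv′))
            (inj₂ swapped) → increasing-notSwapped u<v u′<v′ swapped)

  -- The n basic vertices, k and the choose2 n wedges would be m + 1 distinct vertices.
  wedges-exhaust : ∀ {k} → ¬ Basic n k → ¬ ¬ Any (λ p → wedgeOf p ≡ k) (increasingPairs n)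
  wedges-exhaust {k} ¬bk k∉wedges = <-irrefl refl $ begin-strict
    m                              ≡⟨ m≡ ⟩
    n + choose2 n                  <⟨ +-monoʳ-< n (n<1+n (choose2 n)) ⟩
    n + suc (choose2 n)            ≡⟨ length-vertices ⟨
    length vertices                ≤⟨ unique-⊆⇒length≤ vertices-unique (λ _ → ∈-allFin _) ⟩
    length (allFin m)              ≡⟨ length-tabulate id ⟩
    m                              ∎
    where
    open ≤-Reasoning

    basics wedges vertices : List (Fin m)
    basics = map basic (allFin n)
    wedges = map wedgeOf (increasingPairs n)
    vertices = basics ++ k ∷ wedges

    length-vertices : length vertices ≡ n + suc (choose2 n)
    length-vertices = trans (length-++ basics)
      (cong₂ _+_ (trans (length-map basic (allFin n)) (length-tabulate id))
                 (cong suc (trans (length-map wedgeOf (increasingPairs n)) (length-increasingPairs n))))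

    basics-basic : ∀ {i} → i ∈ basics → Basic n i
    basics-basic i∈ with u , _ , refl ← ∈-map⁻ basic i∈ = basic-isBasic u

    wedges-nonBasic : ∀ {i} → i ∈ wedges → ¬ Basic n i
    wedges-nonBasic i∈ with p , p∈ , refl ← ∈-map⁻ wedgeOf i∈ =
      wedge-nonBasic (wedgeOf-isWedge (FinP.<⇒≢ (∈-increasingPairs⇒< p∈)))

    vertices-unique : Unique vertices
    vertices-unique = Unique.++⁺
      (Unique.map⁺ basic-injective (Unique.allFin⁺ n))
      (All.tabulate (λ w∈ k≡w → k∉wedges (k∈wedges w∈ k≡w))
       ∷ unique-map⁺-injectiveOn wedgeOf (increasingPairs-unique n)
           λ p∈ p′∈ → wedgeOf-injective (∈-increasingPairs⇒< p∈) (∈-increasingPairs⇒< p′∈))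
      λ where
        (i∈ , here refl) → ¬bk (basics-basic i∈)
        (i∈ , there i∈wedges) → wedges-nonBasic i∈wedges (basics-basic i∈)
      where
      k∈wedges : ∀ {w} → w ∈ wedges → k ≡ w → Any (λ p → wedgeOf p ≡ k) (increasingPairs n)
      k∈wedges w∈ refl with p , p∈ , k≡wedge ← ∈-map⁻ wedgeOf w∈ = lose p∈ (sym k≡wedge)

  nonBasic-isWedge : ∀ {k} → ¬ Basic n k →
    ∃₂ λ u v → Basic n u × Basic n v × u ≢ v × IsWedge n G u v k
  nonBasic-isWedge {k} ¬bk with any? (λ p → wedgeOf p FinP.≟ k) (increasingPairs n)
  ... | no k∉wedges = contradiction k∉wedges (wedges-exhaust ¬bk)
  ... | yes k∈wedges with (u , v) , uv∈ , refl ← find k∈wedges =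
    let u≢v = FinP.<⇒≢ (∈-increasingPairs⇒< uv∈) in
    basic u , basic v , basic-isBasic u , basic-isBasic v , u≢v ∘ basic-injective , wedgeOf-isWedge u≢v

  degree-nonBasic : ∀ {k} → ¬ Basic n k → degree G k ≤ 2
  degree-nonBasic ¬bk with _ , _ , _ , _ , _ , k-wedge ← nonBasic-isWedge ¬bk = degree-wedge k-wedge

  nonBasic-neighbours : ∀ {q k l r} → ¬ Basic n q → k ≢ l →
    G q k ≢ x₀ → G q l ≢ x₀ → G q r ≢ x₀ → r ≡ k ⊎ r ≡ l
  nonBasic-neighbours ¬bq k≢l Gqk≢x₀ Gql≢x₀ Gqr≢x₀
    with _ , _ , _ , _ , _ , q-wedge ← nonBasic-isWedge ¬bq
    with wedge-neighbours q-wedge Gqk≢x₀ | wedge-neighbours q-wedge Gql≢x₀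
       | wedge-neighbours q-wedge Gqr≢x₀
  ... | inj₁ refl | inj₁ refl | _         = contradiction refl k≢l
  ... | inj₂ refl | inj₂ refl | _         = contradiction refl k≢l
  ... | inj₁ refl | inj₂ refl | inj₁ refl = inj₁ refl
  ... | inj₁ refl | inj₂ refl | inj₂ refl = inj₂ refl
  ... | inj₂ refl | inj₁ refl | inj₁ refl = inj₂ refl
  ... | inj₂ refl | inj₁ refl | inj₂ refl = inj₁ refl

  -- Besides j, the vertex i is adjacent to the two distinct wedges i ∧ j and i ∧ y.
  degree-basicEdge : 2 < n → ∀ {i j} → Basic n i → Basic n j → i ≢ j → G i j ≢ x₀ → 3 ≤ degree G i
  degree-basicEdge 2<n {i} {j} bi bj i≢j Gij≢x₀
    with (a , b , c) , a≢b , a≢c , b≢c ← three-distinct 2<n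
    with y , by , y≢i , y≢j ← avoid-two FinP._≟_ (basic-isBasic a) (basic-isBasic b) (basic-isBasic c)
                                  (a≢b ∘ basic-injective) (a≢c ∘ basic-injective) (b≢c ∘ basic-injective) i j
    with w , w-wedge ← wedge bi bj i≢j | w′ , w′-wedge ← wedge bi by (y≢i ∘ sym) =
    ≤degree {X = G} {i} {j ∷ w ∷ w′ ∷ []}
      ((basic≢nonBasic bj (wedge-nonBasic w-wedge)
         All.∷ basic≢nonBasic bj (wedge-nonBasic w′-wedge) All.∷ All.[])
       ∷ (wedges-distinct bi bj i≢j bi by (y≢i ∘ sym) w-wedge w′-wedge (λ where
             (inj₁ (_ , j≡y)) → y≢j (sym j≡y)
             (inj₂ (i≡y , _)) → y≢i (sym i≡y)) All.∷ All.[])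
       ∷ All.[] ∷ [])
      λ where
        (here refl) → Gij≢x₀
        (there (here refl)) → wedge-adjacentˡ w-wedge bi
        (there (there (here refl))) → wedge-adjacentˡ w′-wedge bi

-- The φ-graph

module PhiGraph (n : ℕ) {m : ℕ} (G M : LGraph m) where

  private
    Φ : LGraph m
    Φ = phiGraph n G M

    basic-<ᵇ : ∀ {i : Fin m} → Basic n i → (toℕ i <ᵇ n) ≡ true
    basic-<ᵇ {i} = dec-true (toℕ i <? n)

    nonBasic-<ᵇ : ∀ {i : Fin m} → ¬ Basic n i → (toℕ i <ᵇ n) ≡ false
    nonBasic-<ᵇ {i} = dec-false (toℕ i <? n)

  phi-diagonal : ∀ i → Φ i i ≡ M i i
  phi-diagonal i rewrite dec-true (i FinP.≟ i) refl = refl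

  phi-nonEdge : ∀ {i j} → i ≢ j → G i j ≡ x₀ → Φ i j ≡ x₀
  phi-nonEdge {i} {j} i≢j Gij≡x₀ rewrite dec-false (i FinP.≟ j) i≢j | Gij≡x₀ = refl

  phi-basicEdge : ∀ {i j} → i ≢ j → G i j ≢ x₀ → Basic n i × Basic n j → Φ i j ≡ x₀
  phi-basicEdge {i} {j} i≢j Gij≢x₀ (bi , bj)
    rewrite dec-false (i FinP.≟ j) i≢j | dec-false (G i j ≟ x₀) Gij≢x₀
          | basic-<ᵇ bi | basic-<ᵇ bj = refl

  phi-otherEdge : ∀ {i j} → i ≢ j → G i j ≢ x₀ → ¬ (Basic n i × Basic n j) → Φ i j ≡ M i j
  phi-otherEdge {i} {j} i≢j Gij≢x₀ ¬bij
    rewrite dec-false (i FinP.≟ j) i≢j | dec-false (G i j ≟ x₀) Gij≢x₀ with toℕ i <? n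
  ... | no ¬bi rewrite nonBasic-<ᵇ ¬bi = refl
  ... | yes bi rewrite basic-<ᵇ bi | nonBasic-<ᵇ (¬bij ∘ (bi ,_)) = refl

  phi-nonzero⁻ : ∀ {i j} → i ≢ j → Φ i j ≢ x₀ →
    G i j ≢ x₀ × ¬ (Basic n i × Basic n j) × Φ i j ≡ M i j
  phi-nonzero⁻ {i} {j} i≢j Φij≢x₀ = Gij≢x₀ , ¬bij , phi-otherEdge i≢j Gij≢x₀ ¬bij
    where
    Gij≢x₀ : G i j ≢ x₀
    Gij≢x₀ = Φij≢x₀ ∘ phi-nonEdge i≢j

    ¬bij : ¬ (Basic n i × Basic n j)
    ¬bij = Φij≢x₀ ∘ phi-basicEdge i≢j Gij≢x₀

module Theorem (n : ℕ) (2<n : 2 < n) {m : ℕ} (m≡ : m ≡ n + choose2 n)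
               {G : LGraph m} (bg : IsBindingGraph n G)
               {M : LGraph m} (wlG : IsWL G M) {W : LGraph m} (wlΦ : IsWL (phiGraph n G M) W) where

  open BindingGraph n m≡ bg
  open PhiGraph n G M

  private
    Φ : LGraph m
    Φ = phiGraph n G M

    G≥M : G ≥ₘ M
    G≥M = wl-refines wlG

    Φ≥W : Φ ≥ₘ W
    Φ≥W = wl-refines wlΦ

  M-separated : DiagonalSeparated M
  M-separated = wl-separated wlG

  M-stable : Stable M
  M-stable = wl-stable wlG

  W-separated : DiagonalSeparated W
  W-separated = wl-separated wlΦ

  W-stable : Stable W
  W-stable = wl-stable wlΦ

  basic-byDegree : ∀ {i k} → M i i ≡ M k k → 3 ≤ degree G i → Basic n k
  basic-byDegree {k = k} Mii≡Mkk 3≤deg with basic? k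
  ... | yes bk = bk
  ... | no ¬bk = contradiction (degree-nonBasic ¬bk)
                   (<⇒≱ (subst (3 ≤_) (stable-degree G≥M M-stable Mii≡Mkk) 3≤deg))

  basicEdge-colour : ∀ {i j k l} → Basic n i × Basic n j → i ≢ j → G i j ≢ x₀ →
    M i j ≡ M k l → Basic n k × Basic n l
  basicEdge-colour {i} {j} {k} {l} (bi , bj) i≢j Gij≢x₀ Mij≡Mkl =
    basic-byDegree {i} {k} (proj₁ diagonal) (degree-basicEdge 2<n {i} {j} bi bj i≢j Gij≢x₀) ,
    basic-byDegree {j} {l} (proj₂ diagonal)
      (degree-basicEdge 2<n {j} {i} bj bi (i≢j ∘ sym) (Gij≢x₀ ∘ trans (G-symmetric i j)))
    where
    diagonal : M i i ≡ M k k × M j j ≡ M l l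
    diagonal = stable-diagonal M-separated M-stable Mij≡Mkl

  Φ-offDiagonal : ∀ i j k l → i ≢ j → k ≢ l → M i j ≡ M k l → Φ i j ≡ Φ k l
  Φ-offDiagonal i j k l i≢j k≢l Mij≡Mkl
    with G≥M i j k l Mij≡Mkl | G i j ≟ x₀ | basic? i ×-dec basic? j | basic? k ×-dec basic? l
  ... | Gij≡Gkl | yes Gij≡x₀ | _ | _ =
    trans (phi-nonEdge i≢j Gij≡x₀) (sym (phi-nonEdge k≢l (trans (sym Gij≡Gkl) Gij≡x₀)))
  ... | Gij≡Gkl | no Gij≢x₀ | yes bij | yes bkl =
    trans (phi-basicEdge i≢j Gij≢x₀ bij) (sym (phi-basicEdge k≢l (Gij≢x₀ ∘ trans Gij≡Gkl) bkl))
  ... | Gij≡Gkl | no Gij≢x₀ | no ¬bij | no ¬bkl =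
    trans (phi-otherEdge i≢j Gij≢x₀ ¬bij)
          (trans Mij≡Mkl (sym (phi-otherEdge k≢l (Gij≢x₀ ∘ trans Gij≡Gkl) ¬bkl)))
  ... | _ | no Gij≢x₀ | yes bij | no ¬bkl = contradiction (basicEdge-colour bij i≢j Gij≢x₀ Mij≡Mkl) ¬bkl
  ... | Gij≡Gkl | no Gij≢x₀ | no ¬bij | yes bkl =
    contradiction (basicEdge-colour bkl k≢l (Gij≢x₀ ∘ trans Gij≡Gkl) (sym Mij≡Mkl)) ¬bij

  Φ≥M : Φ ≥ₘ M
  Φ≥M = ≥ₘ-byDiagonal M-separated
    (λ i k Mii≡Mkk → trans (phi-diagonal i) (trans Mii≡Mkk (sym (phi-diagonal k))))
    Φ-offDiagonal

  W-otherEdge : ∀ {i j k l} → i ≢ j → G i j ≢ x₀ → ¬ (Basic n i × Basic n j) → W i j ≡ W k l →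
    M i j ≡ M k l × G k l ≢ x₀ × ¬ (Basic n k × Basic n l)
  W-otherEdge {i} {j} {k} {l} i≢j Gij≢x₀ ¬bij Wij≡Wkl =
    trans (sym Φij≡Mij) (trans Φij≡Φkl (proj₂ (proj₂ Φkl-edge))) ,
    proj₁ Φkl-edge , proj₁ (proj₂ Φkl-edge)
    where
    Φij≡Φkl : Φ i j ≡ Φ k l
    Φij≡Φkl = Φ≥W i j k l Wij≡Wkl

    Φij≡Mij : Φ i j ≡ M i j
    Φij≡Mij = phi-otherEdge i≢j Gij≢x₀ ¬bij

    Φkl-edge : G k l ≢ x₀ × ¬ (Basic n k × Basic n l) × Φ k l ≡ M k l
    Φkl-edge = phi-nonzero⁻ (separated-offDiagonal W-separated i≢j Wij≡Wkl)
                 (wl-preserves-edges wlG Gij≢x₀ ∘ trans (sym Φij≡Mij) ∘ trans Φij≡Φkl)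

  MatchedWedge : Fin m → Fin m → Fin m → Fin m → Set
  MatchedWedge i j k l =
    ∃₂ λ w q → IsWedge n G i j w × M i w ≡ M k q × ¬ Basic n q × G q k ≢ x₀ × G q l ≢ x₀

  W-matchedWedge : ∀ {i j k l} → Basic n i × Basic n j → i ≢ j → G i j ≢ x₀ → W i j ≡ W k l →
    MatchedWedge i j k l
  W-matchedWedge {i} {j} {k} {l} (bi , bj) i≢j Gij≢x₀ Wij≡Wkl =
    w , q , w-wedge , proj₁ iw-edge , ¬bq ,
    proj₁ (proj₂ iw-edge) ∘ trans (G-symmetric k q) , proj₁ (proj₂ wj-edge)
    where
    w : Fin m
    w = proj₁ (wedge bi bj i≢j)

    w-wedge : IsWedge n G i j w
    w-wedge = proj₂ (wedge bi bj i≢j)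

    ¬bw : ¬ Basic n w
    ¬bw = wedge-nonBasic w-wedge

    path : ∃ λ q → W i w ≡ W k q × W w j ≡ W q l
    path = stable-path W-stable Wij≡Wkl w

    q : Fin m
    q = proj₁ path

    iw-edge : M i w ≡ M k q × G k q ≢ x₀ × ¬ (Basic n k × Basic n q)
    iw-edge = W-otherEdge (basic≢nonBasic bi ¬bw) (wedge-adjacentˡ w-wedge bi) (¬bw ∘ proj₂)
                          (proj₁ (proj₂ path))

    wj-edge : M w j ≡ M q l × G q l ≢ x₀ × ¬ (Basic n q × Basic n l)
    wj-edge = W-otherEdge (basic≢nonBasic bj ¬bw ∘ sym) (wedge-adjacentʳ w-wedge bj) (¬bw ∘ proj₁)
                          (proj₂ (proj₂ path))

    bk : Basic n k
    bk = basic-byDegree {i} {k} (proj₁ (stable-diagonal M-separated M-stable (proj₁ iw-edge)))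
                       (degree-basicEdge 2<n {i} {j} bi bj i≢j Gij≢x₀)

    ¬bq : ¬ Basic n q
    ¬bq bq = proj₂ (proj₂ iw-edge) (bk , bq)

  -- Stability of M moves the path i, j, w to a path k, r, q along an edge r q; so r is k or l,
  -- and r ≡ k would put M i j on the diagonal.
  matchedWedge⇒sameEdge : ∀ {i j k l} → i ≢ j → Basic n j → k ≢ l →
    MatchedWedge i j k l → G k l ≡ G i j
  matchedWedge⇒sameEdge {i} {j} {k} {l} i≢j bj k≢l
                        (w , q , w-wedge , Miw≡Mkq , ¬bq , Gqk≢x₀ , Gql≢x₀) =
    case nonBasic-neighbours ¬bq k≢l Gqk≢x₀ Gql≢x₀ Gqr≢x₀ of λ where
      (inj₁ r≡k) → contradiction (M-separated k i j (subst (λ x → M i j ≡ M k x) r≡k Mij≡Mkr)) i≢j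
      (inj₂ r≡l) → sym (G≥M i j k l (subst (λ x → M i j ≡ M k x) r≡l Mij≡Mkr))
    where
    path : ∃ λ r → M i j ≡ M k r × M j w ≡ M r q
    path = stable-path M-stable Miw≡Mkq j

    r : Fin m
    r = proj₁ path

    Mij≡Mkr : M i j ≡ M k r
    Mij≡Mkr = proj₁ (proj₂ path)

    Gqr≢x₀ : G q r ≢ x₀
    Gqr≢x₀ = wedge-adjacentʳ w-wedge bj ∘ trans (G-symmetric w j)
             ∘ trans (G≥M j w r q (proj₂ (proj₂ path))) ∘ trans (G-symmetric r q)

  W-basicEdge : ∀ {i j k l} → Basic n i × Basic n j → i ≢ j → G i j ≢ x₀ →
    W i j ≡ W k l → G k l ≡ G i j
  W-basicEdge (bi , bj) i≢j Gij≢x₀ Wij≡Wkl =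
    matchedWedge⇒sameEdge i≢j bj (separated-offDiagonal W-separated i≢j Wij≡Wkl)
                          (W-matchedWedge (bi , bj) i≢j Gij≢x₀ Wij≡Wkl)

  phi-zeroEdge⇒basic : ∀ {i j} → i ≢ j → G i j ≢ x₀ → Φ i j ≡ x₀ → Basic n i × Basic n j
  phi-zeroEdge⇒basic {i} {j} i≢j Gij≢x₀ Φij≡x₀ with basic? i ×-dec basic? j
  ... | yes bij = bij
  ... | no ¬bij = contradiction (trans (sym (phi-otherEdge i≢j Gij≢x₀ ¬bij)) Φij≡x₀)
                                (wl-preserves-edges wlG Gij≢x₀)

  G-offDiagonal : ∀ i j k l → i ≢ j → k ≢ l → W i j ≡ W k l → G i j ≡ G k l
  G-offDiagonal i j k l i≢j k≢l Wij≡Wkl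
    with Φ≥W i j k l Wij≡Wkl | Φ i j ≟ x₀ | G i j ≟ x₀ | G k l ≟ x₀
  ... | Φij≡Φkl | no Φij≢x₀ | _ | _ = edges-sameLabel
    (proj₁ (phi-nonzero⁻ i≢j Φij≢x₀)) (proj₁ (phi-nonzero⁻ k≢l (Φij≢x₀ ∘ trans Φij≡Φkl)))
  ... | _ | yes _ | yes Gij≡x₀ | yes Gkl≡x₀ = trans Gij≡x₀ (sym Gkl≡x₀)
  ... | _ | yes Φij≡x₀ | no Gij≢x₀ | _ =
    sym (W-basicEdge (phi-zeroEdge⇒basic i≢j Gij≢x₀ Φij≡x₀) i≢j Gij≢x₀ Wij≡Wkl)
  ... | Φij≡Φkl | yes Φij≡x₀ | yes _ | no Gkl≢x₀ =
    W-basicEdge (phi-zeroEdge⇒basic k≢l Gkl≢x₀ (trans (sym Φij≡Φkl) Φij≡x₀))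
                k≢l Gkl≢x₀ (sym Wij≡Wkl)

  G≥W : G ≥ₘ W
  G≥W = ≥ₘ-byDiagonal W-separated (λ i k _ → trans (G-loopless i) (sym (G-loopless k))) G-offDiagonal

theorem7p1 : ∀ (n : ℕ) → 2 < n →
    (G : LGraph (n * suc n / 2)) → IsBindingGraph n G →
    (M : LGraph (n * suc n / 2)) → IsWL G M →
    (W : LGraph (n * suc n / 2)) → IsWL (phiGraph n G M) W →
    (W ≈ₘ M) ×
    SameAut (phiGraph n G M) W ×
    SameAut W M ×
    SameAut M G
theorem7p1 n 2<n G bg M wlG W wlΦ =
  W≈M , wl-sameAut wlΦ , ≈ₘ⇒sameAut W≈M , sameAut-sym (wl-sameAut wlG)
  where
  open Theorem n 2<n (n*[1+n]/2≡n+choose2 n) bg wlG wlΦ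

  W≈M : W ≈ₘ M
  W≈M = wl-coarsest wlΦ M-separated M-stable Φ≥M , wl-coarsest wlG W-separated W-stable G≥W
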